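{- Let $r,D$ be positive integers and let $F:\mathbb{Z}^r\to\mathbb{Z}$ be periodic with period $D$ in each component. Let $\xi\in\mathbb{C}$ satisfy $\xi^D=1$ (not necessarily primitive). For $n\ge0$ define $$S(n)=\sum_{q_1=0}^n\sum_{q_2=0}^{n-q_1}\cdots\sum_{q_r=0}^{n-q_1-\cdots-q_{r-1}} \binom{n}{q_1}\binom{n-q_1}{q_2}\cdots\binom{n-q_1-\cdots -q_{r-1}}{q_r}\xi^{F(q_1,\dots,q_r)}.$$ Then $$ S(n)=\sum_{j_1=0}^{D-1}\sum_{j_2=0}^{j_1}\cdots \sum_{j_r=0}^{j_{r-1}}c_{j_1,\dots,j_r}(D)\left(1+\xi_D^{ -j_1}+\cdots+\xi_D^{ -j_r}\right)^n,$$ where $$ c_{j_1,\dots, j_r}(D)=\frac{1}{D^r}\sum_{b_r=0}^{D-1}\cdots \sum_{b_1=0}^{D-1} \xi^{F(b_1,\dots,b_r)}\sum_{(j_1',\dots,j_r')\in \mathrm{Sym}(j_1,\dots, j_r)}\xi_D^{j_1'b_r+\cdots+j_r' b_1},$$ and $\xi_D=\exp(2\pi i/D)$.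
   Context: $F$ periodic with period $D$ in each component means $F(q_1,\dots,q_j+D,\dots,q_r)=F(q_1,\dots,q_r)$ for all $j$ and all integer tuples. $\mathrm{Sym}(j_1,\dots,j_r)$ denotes the set of all distinct rearrangements (permutations of the entries) of the tuple $(j_1,\dots,j_r)$. -}

module Defs where

open import Level using (Level)
open import Algebra.Bundles using (CommutativeRing)
open import Data.Nat as ℕ using (ℕ; zero; suc; _∸_)
open import Data.Nat.Combinatorics using (_C_)
open import Data.Integer as ℤ using (ℤ; +_; -[1+_])
open import Data.Fin using (Fin)
open import Data.Vec using (Vec; []; _∷_; _[_]%=_; reverse; zipWith; foldr; map)
open import Data.List using (List)
import Data.List as L
open import Relation.Binary.PropositionalEquality using (_≡_)

Periodic : {r : ℕ} → ℕ → (Vec ℤ r → ℤ) → Set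
Periodic {r} D F = ∀ (q : Vec ℤ r) (i : Fin r) → F (q [ i ]%= (λ x → x ℤ.+ + D)) ≡ F q

-- dot product j'_1 b_r + ... + j'_r b_1  (b reversed)
revDot : {r : ℕ} → Vec ℕ r → Vec ℕ r → ℕ
revDot j b = foldr _ ℕ._+_ 0 (zipWith ℕ._*_ j (reverse b))

module Ops {c ℓ : Level} (R : CommutativeRing c ℓ) where
  open CommutativeRing R

  fromℕ : ℕ → Carrier
  fromℕ zero = 0#
  fromℕ (suc n) = 1# + fromℕ n

  pow : Carrier → ℕ → Carrier
  pow x zero = 1#
  pow x (suc n) = x * pow x n

  zpow : Carrier → Carrier → ℤ → Carrier
  zpow x xinv (+ n) = pow x n
  zpow x xinv -[1+ n ] = pow xinv (suc n)

  sumTo : ℕ → (ℕ → Carrier) → Carrier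
  sumTo zero f = f 0
  sumTo (suc n) f = sumTo n f + f (suc n)

  sumBelow : ℕ → (ℕ → Carrier) → Carrier
  sumBelow zero f = 0#
  sumBelow (suc n) f = sumBelow n f + f n

  listSum : List Carrier → Carrier
  listSum = L.foldr _+_ 0#

  multiSum : (r : ℕ) → ℕ → (Vec ℕ r → Carrier) → Carrier
  multiSum zero n g = g []
  multiSum (suc r) n g = sumTo n (λ q → fromℕ (n C q) * multiSum r (n ∸ q) (λ v → g (q ∷ v)))

  decSum : (r : ℕ) → ℕ → (Vec ℕ r → Carrier) → Carrier
  decSum zero m g = g []
  decSum (suc r) m g = sumTo m (λ j → decSum r j (λ v → g (j ∷ v)))

  boxSum : (r : ℕ) → ℕ → (Vec ℕ r → Carrier) → Carrier
  boxSum zero D g = g []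
  boxSum (suc r) D g = sumBelow D (λ b → boxSum r D (λ v → g (b ∷ v)))

  module Setup {r : ℕ} (D : ℕ) (F : Vec ℤ r → ℤ)
               (ξ ξinv ζ ζinv δ : Carrier)
               (sym : Vec ℕ r → List (Vec ℕ r)) where
    -- ξ_D is played by ζ, ξ_D^{-1} by ζinv, 1/D by δ; sym j enumerates Sym(j)

    S : ℕ → Carrier
    S n = multiSum r n (λ q → zpow ξ ξinv (F (map +_ q)))

    coeff : Vec ℕ r → Carrier
    coeff j = pow δ r * boxSum r D (λ b →
                zpow ξ ξinv (F (map +_ b)) *
                listSum (L.map (λ j' → pow ζ (revDot j' b)) (sym j)))

    base : Vec ℕ r → Carrier
    base j = 1# + foldr _ _+_ 0# (map (pow ζinv) j)

    RHS : ℕ → Carrier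
    RHS n = decSum r (D ∸ 1) (λ j → coeff j * pow (base j) n)

-- With f q = ξ ^ F q, a function of q mod D, discrete Fourier inversion on (ℤ/D)^r writes
-- f q = Σ_a K a ζ^(-⟨a,q⟩) with K a = D^(-r) Σ_b f b ζ^⟨a,b⟩; it rests on the orthogonality of
-- characters, i.e. on the vanishing of geometric sums of D-th roots of unity other than 1 in a domain.
-- Substituted into S n, the multinomial theorem turns the inner sums into (1 + Σ_i ζ^(-a_i))^n,
-- a base depending only on the multiset of entries of a. Grouping the a by their descending
-- rearrangement j, the index of the outer sum on the right, collects the K a into c_j(D).

module Submission where

open import Defs
open import Algebra.Bundles using (CommutativeRing)
open import Data.Nat using (ℕ; suc; _≤_; _<_)
open import Data.Integer using (ℤ)
open import Data.Vec using (Vec; toList)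
open import Data.List using (List)
open import Data.List.Relation.Unary.Unique.Propositional using (Unique)
open import Data.List.Membership.Propositional using (_∈_)
open import Data.List.Relation.Binary.Permutation.Propositional using (_↭_)
open import Data.Sum using (_⊎_)
open import Relation.Nullary using (¬_)
open import Function.Bundles using (_⇔_)

open import Level using (_⊔_)
open import Data.Bool using (if_then_else_)
open import Data.Empty using (⊥-elim)
open import Data.Unit using (⊤; tt)
open import Data.Product using (_×_; _,_; proj₂)
open import Data.Sum using (inj₁; inj₂; [_,_]′)
open import Data.Nat as ℕ using (zero; _∸_; s≤s; NonZero)
open import Data.Nat.Properties as ℕ
  using (≤-refl; ≤-trans; ≤-antisym; <⇒≤; ≰⇒>; ≤-pred; m<n⇒m<1+n; ≤∧≢⇒<; m≤n⇒m<n∨m≡n;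
         m<n⇒0<n∸m; m∸n≤m; ≤-<-trans; m+[n∸m]≡n; <⇒≤pred; <-irrefl)
open import Data.Nat.DivMod using (_%_; _/_; m≡m%n+[m/n]*n; m%n<n)
open import Data.Nat.Combinatorics using (_C_)
import Data.Integer as ℤ
open import Data.Fin as Fin using (Fin; toℕ)
open import Data.Fin.Properties using (toℕ-fromℕ; toℕ-inject₁)
open import Data.Vec as Vec using ([]; _∷_; _∷ʳ_; reverse; zipWith)
open import Data.Vec.Properties
  using (reverse-∷; reverse-involutive; map-reverse; toList-map; toList-reverse; ∷-injectiveˡ; ∷-injectiveʳ; ≡-dec)
open import Data.List as List using ([]; _∷_)
open import Data.List.Relation.Unary.All as All using (All; []; _∷_)
open import Data.List.Relation.Unary.AllPairs using ([]; _∷_)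
open import Data.List.Relation.Unary.Any using (here; there)
open import Data.List.Relation.Binary.Permutation.Propositional using (↭-refl; ↭-sym; ↭-trans; prep; swap)
open import Data.List.Relation.Binary.Permutation.Propositional.Properties
  using (∈-resp-↭; drop-∷; All-resp-↭; map⁺; ↭-reverse)
open import Function.Base using (_∘_)
open import Function.Bundles using (Equivalence)
open import Relation.Nullary using (Dec; does; yes; no; _⊎-dec_)
open import Relation.Binary.Definitions using (DecidableEquality)
open import Relation.Binary.PropositionalEquality as ≡ using (_≡_; _≢_; cong; cong₂)

dot : ∀ {n} → Vec ℕ n → Vec ℕ n → ℕ
dot a b = Vec.foldr _ ℕ._+_ 0 (zipWith ℕ._*_ a b)

dot-∷ʳ : ∀ {n} (a b : Vec ℕ n) x y → dot (a ∷ʳ x) (b ∷ʳ y) ≡ dot a b ℕ.+ x ℕ.* y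
dot-∷ʳ [] [] x y = ℕ.+-comm (x ℕ.* y) 0
dot-∷ʳ (a₀ ∷ a) (b₀ ∷ b) x y =
  ≡.trans (cong (a₀ ℕ.* b₀ ℕ.+_) (dot-∷ʳ a b x y)) (≡.sym (ℕ.+-assoc (a₀ ℕ.* b₀) _ _))

dot-reverse-reverse : ∀ {n} (a b : Vec ℕ n) → dot (reverse a) (reverse b) ≡ dot a b
dot-reverse-reverse [] [] = ≡.refl
dot-reverse-reverse (a₀ ∷ a) (b₀ ∷ b)
  rewrite reverse-∷ a₀ a | reverse-∷ b₀ b | dot-∷ʳ (reverse a) (reverse b) a₀ b₀ | dot-reverse-reverse a b
  = ℕ.+-comm (dot a b) (a₀ ℕ.* b₀)

revDot≡dot-reverse : ∀ {n} (a b : Vec ℕ n) → revDot a b ≡ dot (reverse a) b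
revDot≡dot-reverse a b =
  ≡.trans (cong (λ a′ → dot a′ (reverse b)) (≡.sym (reverse-involutive a))) (dot-reverse-reverse (reverse a) b)

module _ {D : ℕ} where

  periodic-tail : ∀ {r} {F : Vec ℤ (suc r) → ℤ} → Periodic D F → ∀ x → Periodic D (λ v → F (x ∷ v))
  periodic-tail per x v i = per (x ∷ v) (Fin.suc i)

  periodic-head : ∀ {r} {F : Vec ℤ (suc r) → ℤ} → Periodic D F →
                  ∀ a k v → F (ℤ.+ (a ℕ.+ k ℕ.* D) ∷ v) ≡ F (ℤ.+ a ∷ v)
  periodic-head {F = F} per a zero v = cong (λ m → F (ℤ.+ m ∷ v)) (ℕ.+-identityʳ a)
  periodic-head {F = F} per a (suc k) v = ≡.trans (cong (λ m → F (ℤ.+ m ∷ v)) shift)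
    (≡.trans (per (ℤ.+ (a ℕ.+ k ℕ.* D) ∷ v) Fin.zero) (periodic-head per a k v))
    where
    shift : a ℕ.+ (D ℕ.+ k ℕ.* D) ≡ a ℕ.+ k ℕ.* D ℕ.+ D
    shift = ≡.trans (cong (a ℕ.+_) (ℕ.+-comm D (k ℕ.* D))) (≡.sym (ℕ.+-assoc a (k ℕ.* D) D))

  periodic-mod : ∀ {r} {F : Vec ℤ r → ℤ} .{{_ : NonZero D}} → Periodic D F →
                 ∀ q → F (Vec.map ℤ.+_ (Vec.map (_% D) q)) ≡ F (Vec.map ℤ.+_ q)
  periodic-mod per [] = ≡.refl
  periodic-mod {F = F} per (q ∷ qs) = begin
    F (ℤ.+ (q % D) ∷ Vec.map ℤ.+_ (Vec.map (_% D) qs))  ≡⟨ periodic-mod (periodic-tail per (ℤ.+ (q % D))) qs ⟩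
    F (ℤ.+ (q % D) ∷ Vec.map ℤ.+_ qs)                   ≡⟨ periodic-head per (q % D) (q / D) _ ⟨
    F (ℤ.+ (q % D ℕ.+ q / D ℕ.* D) ∷ Vec.map ℤ.+_ qs)   ≡⟨ cong (λ m → F (ℤ.+ m ∷ Vec.map ℤ.+_ qs)) (m≡m%n+[m/n]*n q D) ⟨
    F (ℤ.+ q ∷ Vec.map ℤ.+_ qs)                         ∎
    where open ≡.≡-Reasoning

Descending : ∀ {n} → ℕ → Vec ℕ n → Set
Descending m [] = ⊤
Descending m (x ∷ v) = x ≤ m × Descending x v

InBox : ∀ {n} → ℕ → Vec ℕ n → Set
InBox D v = All (_< D) (toList v)

insertDesc : ∀ {n} → ℕ → Vec ℕ n → Vec ℕ (suc n)
insertDesc x [] = x ∷ []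
insertDesc x (y ∷ v) with y ℕ.≤? x
... | yes _ = x ∷ y ∷ v
... | no _ = y ∷ insertDesc x v

sortDesc : ∀ {n} → Vec ℕ n → Vec ℕ n
sortDesc [] = []
sortDesc (x ∷ v) = insertDesc x (sortDesc v)

insertDesc-↭ : ∀ {n} x (v : Vec ℕ n) → toList (insertDesc x v) ↭ x ∷ toList v
insertDesc-↭ x [] = ↭-refl
insertDesc-↭ x (y ∷ v) with y ℕ.≤? x
... | yes _ = ↭-refl
... | no _ = ↭-trans (prep y (insertDesc-↭ x v)) (swap y x ↭-refl)

sortDesc-↭ : ∀ {n} (v : Vec ℕ n) → toList (sortDesc v) ↭ toList v
sortDesc-↭ [] = ↭-refl
sortDesc-↭ (x ∷ v) = ↭-trans (insertDesc-↭ x (sortDesc v)) (prep x (sortDesc-↭ v))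

insertDesc-descending : ∀ {n} m x (v : Vec ℕ n) → x ≤ m → Descending m v → Descending m (insertDesc x v)
insertDesc-descending m x [] x≤m _ = x≤m , tt
insertDesc-descending m x (y ∷ v) x≤m (y≤m , desc) with y ℕ.≤? x
... | yes y≤x = x≤m , y≤x , desc
... | no y≰x = y≤m , insertDesc-descending y x v (<⇒≤ (≰⇒> y≰x)) desc

sortDesc-descending : ∀ {n} m (v : Vec ℕ n) → InBox (suc m) v → Descending m (sortDesc v)
sortDesc-descending m [] _ = tt
sortDesc-descending m (x ∷ v) (x<m ∷ inBox) =
  insertDesc-descending m x (sortDesc v) (<⇒≤pred x<m) (sortDesc-descending m v inBox)

descending-bounded : ∀ {n m z} (v : Vec ℕ n) → Descending m v → z ∈ toList v → z ≤ m
descending-bounded (x ∷ v) (x≤m , _) (here ≡.refl) = x≤m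
descending-bounded (x ∷ v) (x≤m , desc) (there z∈v) = ≤-trans (descending-bounded v desc z∈v) x≤m

descending-inBox : ∀ {n} m (v : Vec ℕ n) → Descending m v → InBox (suc m) v
descending-inBox m v desc = All.tabulate (λ z∈v → s≤s (descending-bounded v desc z∈v))

head-maximal : ∀ {n m z y} (v : Vec ℕ n) → Descending m (y ∷ v) → z ∈ toList (y ∷ v) → z ≤ y
head-maximal v _ (here ≡.refl) = ≤-refl
head-maximal v (_ , desc) (there z∈v) = descending-bounded v desc z∈v

descending-↭-unique : ∀ {n m m′} (u v : Vec ℕ n) → Descending m u → Descending m′ v → toList u ↭ toList v → u ≡ v
descending-↭-unique [] [] _ _ _ = ≡.refl
descending-↭-unique {m = m} {m′} (x ∷ u) (y ∷ v) du dv p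
  with ≤-antisym (head-maximal {m = m′} v dv (∈-resp-↭ p (here ≡.refl)))
                 (head-maximal {m = m} u du (∈-resp-↭ (↭-sym p) (here ≡.refl)))
... | ≡.refl = cong (x ∷_) (descending-↭-unique u v (proj₂ du) (proj₂ dv) (drop-∷ p))

module Powers {c ℓ} (R : CommutativeRing c ℓ) where
  open CommutativeRing R
  open Ops R
  open import Algebra.Properties.Semiring.Mult semiring using (×-assoc-*; ×-congʳ) renaming (_×_ to _·_)
  open import Algebra.Properties.CommutativeSemiring.Exp commutativeSemiring
    using (_^_; ^-congˡ; ^-homo-*; ^-assocʳ; ^-distrib-*)

  pow≡^ : ∀ x n → pow x n ≡ x ^ n
  pow≡^ x zero = ≡.refl
  pow≡^ x (suc n) = cong (x *_) (pow≡^ x n)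

  fromℕ≡·1# : ∀ n → fromℕ n ≡ n · 1#
  fromℕ≡·1# zero = ≡.refl
  fromℕ≡·1# (suc n) = cong (1# +_) (fromℕ≡·1# n)

  pow-cong : ∀ {x y} n → x ≈ y → pow x n ≈ pow y n
  pow-cong {x} {y} n x≈y rewrite pow≡^ x n | pow≡^ y n = ^-congˡ n x≈y

  pow-+ : ∀ x m n → pow x (m ℕ.+ n) ≈ pow x m * pow x n
  pow-+ x m n rewrite pow≡^ x (m ℕ.+ n) | pow≡^ x m | pow≡^ x n = ^-homo-* x m n

  pow-* : ∀ x m n → pow x (m ℕ.* n) ≈ pow (pow x m) n
  pow-* x m n rewrite pow≡^ x (m ℕ.* n) | pow≡^ x m | pow≡^ (x ^ m) n = sym (^-assocʳ x m n)

  pow-distrib-* : ∀ x y n → pow (x * y) n ≈ pow x n * pow y n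
  pow-distrib-* x y n rewrite pow≡^ (x * y) n | pow≡^ x n | pow≡^ y n = ^-distrib-* x y n

  pow-1# : ∀ n → pow 1# n ≈ 1#
  pow-1# zero = refl
  pow-1# (suc n) = trans (*-identityˡ _) (pow-1# n)

  fromℕ-*≈· : ∀ n x → fromℕ n * x ≈ n · x
  fromℕ-*≈· n x rewrite fromℕ≡·1# n = trans (×-assoc-* n 1# x) (×-congʳ n (*-identityˡ x))

module Sums {c ℓ} (R : CommutativeRing c ℓ) where
  open CommutativeRing R
  open Ops R
  import Data.List.Relation.Binary.Permutation.Setoid.Properties setoid as SetoidPerm
  open import Data.List.Relation.Binary.Permutation.Propositional using (↭⇒↭ₛ′)
  open import Algebra.Properties.CommutativeSemigroup +-commutativeSemigroup public
    using () renaming (interchange to +-interchange; x∙yz≈y∙xz to +-leftComm)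
  open import Algebra.Properties.CommutativeSemigroup *-commutativeSemigroup public
    using () renaming (interchange to *-interchange; x∙yz≈y∙xz to *-leftComm)
  open import Relation.Binary.Reasoning.Setoid setoid

  sumTo≈sumBelow : ∀ n f → sumTo n f ≈ sumBelow (suc n) f
  sumTo≈sumBelow zero f = sym (+-identityˡ (f 0))
  sumTo≈sumBelow (suc n) f = +-congʳ (sumTo≈sumBelow n f)

  sumBelow-cong< : ∀ n {f g : ℕ → Carrier} → (∀ k → k < n → f k ≈ g k) → sumBelow n f ≈ sumBelow n g
  sumBelow-cong< zero f≈g = refl
  sumBelow-cong< (suc n) f≈g = +-cong (sumBelow-cong< n (λ k k<n → f≈g k (m<n⇒m<1+n k<n))) (f≈g n ≤-refl)

  sumBelow-+ : ∀ n (f g : ℕ → Carrier) → sumBelow n (λ k → f k + g k) ≈ sumBelow n f + sumBelow n g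
  sumBelow-+ zero f g = sym (+-identityˡ 0#)
  sumBelow-+ (suc n) f g = trans (+-congʳ (sumBelow-+ n f g)) (+-interchange _ _ _ _)

  sumBelow-*ˡ : ∀ n x (f : ℕ → Carrier) → sumBelow n (λ k → x * f k) ≈ x * sumBelow n f
  sumBelow-*ˡ zero x f = sym (zeroʳ x)
  sumBelow-*ˡ (suc n) x f = trans (+-congʳ (sumBelow-*ˡ n x f)) (sym (distribˡ x _ _))

  sumBelow-1# : ∀ n → sumBelow n (λ _ → 1#) ≈ fromℕ n
  sumBelow-1# zero = refl
  sumBelow-1# (suc n) = trans (+-congʳ (sumBelow-1# n)) (+-comm _ _)

  record IsLinear {I : Set} (L : (I → Carrier) → Carrier) : Set (c ⊔ ℓ) where
    field
      lin-cong : ∀ {f g} → (∀ i → f i ≈ g i) → L f ≈ L g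
      lin-+ : ∀ f g → L (λ i → f i + g i) ≈ L f + L g
      lin-*ˡ : ∀ x f → L (λ i → x * f i) ≈ x * L f

    lin-0# : L (λ _ → 0#) ≈ 0#
    lin-0# = begin
      L (λ _ → 0#)      ≈⟨ lin-cong (λ _ → zeroˡ 0#) ⟨
      L (λ _ → 0# * 0#) ≈⟨ lin-*ˡ 0# (λ _ → 0#) ⟩
      0# * L (λ _ → 0#) ≈⟨ zeroˡ _ ⟩
      0#                ∎

    lin-*ʳ : ∀ x f → L (λ i → f i * x) ≈ L f * x
    lin-*ʳ x f = trans (lin-cong (λ i → *-comm (f i) x)) (trans (lin-*ˡ x f) (*-comm x (L f)))

  open IsLinear public

  isLinear-resp : ∀ {I : Set} {L L′ : (I → Carrier) → Carrier} → (∀ f → L f ≈ L′ f) → IsLinear L′ → IsLinear L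
  isLinear-resp L≈L′ lin = record
    { lin-cong = λ f≈g → trans (L≈L′ _) (trans (lin-cong lin f≈g) (sym (L≈L′ _)))
    ; lin-+ = λ f g → trans (L≈L′ _) (trans (lin-+ lin f g) (sym (+-cong (L≈L′ f) (L≈L′ g))))
    ; lin-*ˡ = λ x f → trans (L≈L′ _) (trans (lin-*ˡ lin x f) (*-congˡ (sym (L≈L′ f))))
    }

  eval-isLinear : ∀ {I : Set} (i : I) → IsLinear (λ f → f i)
  eval-isLinear i = record { lin-cong = λ f≈g → f≈g i ; lin-+ = λ _ _ → refl ; lin-*ˡ = λ _ _ → refl }

  scaled-isLinear : ∀ {I : Set} {L : (I → Carrier) → Carrier} x → IsLinear L → IsLinear (λ f → x * L f)
  scaled-isLinear x lin = record
    { lin-cong = λ f≈g → *-congˡ (lin-cong lin f≈g)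
    ; lin-+ = λ f g → trans (*-congˡ (lin-+ lin f g)) (distribˡ x _ _)
    ; lin-*ˡ = λ y f → trans (*-congˡ (lin-*ˡ lin y f)) (*-leftComm x y _)
    }

  nested-isLinear : ∀ {J I K : Set} {O : (J → Carrier) → Carrier} {L : J → (I → Carrier) → Carrier}
    (u : J → I → K) → IsLinear O → (∀ j → IsLinear (L j)) → IsLinear (λ f → O (λ j → L j (λ i → f (u j i))))
  nested-isLinear u linO linL = record
    { lin-cong = λ f≈g → lin-cong linO (λ j → lin-cong (linL j) (λ i → f≈g (u j i)))
    ; lin-+ = λ f g → trans (lin-cong linO (λ j → lin-+ (linL j) _ _)) (lin-+ linO _ _)
    ; lin-*ˡ = λ x f → trans (lin-cong linO (λ j → lin-*ˡ (linL j) x _)) (lin-*ˡ linO x _)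
    }

  sumBelow-isLinear : ∀ n → IsLinear (sumBelow n)
  sumBelow-isLinear n = record
    { lin-cong = λ f≈g → sumBelow-cong< n (λ k _ → f≈g k) ; lin-+ = sumBelow-+ n ; lin-*ˡ = sumBelow-*ˡ n }

  sumTo-isLinear : ∀ n → IsLinear (sumTo n)
  sumTo-isLinear n = isLinear-resp (sumTo≈sumBelow n) (sumBelow-isLinear (suc n))

  boxSum-isLinear : ∀ r D → IsLinear (boxSum r D)
  boxSum-isLinear zero D = eval-isLinear []
  boxSum-isLinear (suc r) D = nested-isLinear _∷_ (sumBelow-isLinear D) (λ _ → boxSum-isLinear r D)

  decSum-isLinear : ∀ r m → IsLinear (decSum r m)
  decSum-isLinear zero m = eval-isLinear []
  decSum-isLinear (suc r) m = nested-isLinear _∷_ (sumTo-isLinear m) (λ j → decSum-isLinear r j)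

  multiSum-isLinear : ∀ r n → IsLinear (multiSum r n)
  multiSum-isLinear zero n = eval-isLinear []
  multiSum-isLinear (suc r) n =
    nested-isLinear _∷_ (sumTo-isLinear n) (λ q → scaled-isLinear (fromℕ (n C q)) (multiSum-isLinear r (n ∸ q)))

  listSum-isLinear : ∀ {X : Set} (xs : List X) → IsLinear (λ h → listSum (List.map h xs))
  listSum-isLinear [] = record { lin-cong = λ _ → refl ; lin-+ = λ _ _ → sym (+-identityˡ 0#) ; lin-*ˡ = λ x _ → sym (zeroʳ x) }
  listSum-isLinear (x ∷ xs) = record
    { lin-cong = λ f≈g → +-cong (f≈g x) (lin-cong rest f≈g)
    ; lin-+ = λ f g → trans (+-congˡ (lin-+ rest f g)) (+-interchange _ _ _ _)
    ; lin-*ˡ = λ y f → trans (+-congˡ (lin-*ˡ rest y f)) (sym (distribˡ y _ _))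
    }
    where rest = listSum-isLinear xs

  module _ {I : Set} {L : (I → Carrier) → Carrier} (lin : IsLinear L) where

    lin-sumBelow : ∀ n (h : ℕ → I → Carrier) → L (λ i → sumBelow n (λ k → h k i)) ≈ sumBelow n (λ k → L (h k))
    lin-sumBelow zero h = lin-0# lin
    lin-sumBelow (suc n) h = trans (lin-+ lin _ _) (+-congʳ (lin-sumBelow n h))

    lin-boxSum : ∀ r D (h : Vec ℕ r → I → Carrier) → L (λ i → boxSum r D (λ a → h a i)) ≈ boxSum r D (λ a → L (h a))
    lin-boxSum zero D h = refl
    lin-boxSum (suc r) D h =
      trans (lin-sumBelow D _) (sumBelow-cong< D (λ b _ → lin-boxSum r D (λ a → h (b ∷ a))))

    lin-listSum : ∀ {X : Set} (xs : List X) (h : X → I → Carrier) →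
                  L (λ i → listSum (List.map (λ x → h x i) xs)) ≈ listSum (List.map (λ x → L (h x)) xs)
    lin-listSum [] h = lin-0# lin
    lin-listSum (x ∷ xs) h = trans (lin-+ lin _ _) (+-congˡ (lin-listSum xs h))

  sumBelow-delta : ∀ n (f : ℕ → Carrier) t → t < n → (∀ k → k < n → k ≢ t → f k ≈ 0#) → sumBelow n f ≈ f t
  sumBelow-delta (suc n) f t t<1+n f≈0 with t ℕ.≟ n
  ... | yes ≡.refl = trans (+-congʳ below) (+-identityˡ _)
    where
    below : sumBelow n f ≈ 0#
    below = trans (sumBelow-cong< n (λ k k<n → f≈0 k (m<n⇒m<1+n k<n) (λ { ≡.refl → <-irrefl ≡.refl k<n })))
                  (lin-0# (sumBelow-isLinear n))
  ... | no t≢n = trans (+-cong (sumBelow-delta n f t (≤∧≢⇒< (≤-pred t<1+n) t≢n) (λ k k<n → f≈0 k (m<n⇒m<1+n k<n)))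
                               (f≈0 n ≤-refl (t≢n ∘ ≡.sym)))
                       (+-identityʳ _)

  sumTo-cong≤ : ∀ n {f g : ℕ → Carrier} → (∀ k → k ≤ n → f k ≈ g k) → sumTo n f ≈ sumTo n g
  sumTo-cong≤ zero f≈g = f≈g 0 ℕ.z≤n
  sumTo-cong≤ (suc n) f≈g = +-cong (sumTo-cong≤ n (λ k k≤n → f≈g k (ℕ.m≤n⇒m≤1+n k≤n))) (f≈g (suc n) ≤-refl)

  boxSum-cong : ∀ r D {g h : Vec ℕ r → Carrier} → (∀ a → InBox D a → g a ≈ h a) → boxSum r D g ≈ boxSum r D h
  boxSum-cong zero D g≈h = g≈h [] []
  boxSum-cong (suc r) D g≈h = sumBelow-cong< D (λ b b<D → boxSum-cong r D (λ a a∈ → g≈h (b ∷ a) (b<D ∷ a∈)))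

  boxSum-delta : ∀ r D (g : Vec ℕ r → Carrier) x → InBox D x →
                 (∀ a → InBox D a → a ≢ x → g a ≈ 0#) → boxSum r D g ≈ g x
  boxSum-delta zero D g [] _ _ = refl
  boxSum-delta (suc r) D g (x₀ ∷ x) (x₀<D ∷ x∈) g≈0 = trans
    (sumBelow-delta D _ x₀ x₀<D (λ k k<D k≢x₀ → trans
      (boxSum-cong r D (λ a a∈ → g≈0 (k ∷ a) (k<D ∷ a∈) (k≢x₀ ∘ ∷-injectiveˡ)))
      (lin-0# (boxSum-isLinear r D))))
    (boxSum-delta r D (λ a → g (x₀ ∷ a)) x x∈ (λ a a∈ a≢x → g≈0 (x₀ ∷ a) (x₀<D ∷ a∈) (a≢x ∘ ∷-injectiveʳ)))

  decSum-cong : ∀ r m {g h : Vec ℕ r → Carrier} → (∀ a → Descending m a → g a ≈ h a) → decSum r m g ≈ decSum r m h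
  decSum-cong zero m g≈h = g≈h [] tt
  decSum-cong (suc r) m g≈h = sumTo-cong≤ m (λ j j≤m → decSum-cong r j (λ a desc → g≈h (j ∷ a) (j≤m , desc)))

  decSum-delta : ∀ r m (g : Vec ℕ r → Carrier) x → Descending m x →
                 (∀ a → Descending m a → a ≢ x → g a ≈ 0#) → decSum r m g ≈ g x
  decSum-delta zero m g [] _ _ = refl
  decSum-delta (suc r) m g (x₀ ∷ x) (x₀≤m , desc) g≈0 = trans (sumTo≈sumBelow m _) (trans
    (sumBelow-delta (suc m) _ x₀ (s≤s x₀≤m) (λ k k<1+m k≢x₀ → trans
      (decSum-cong r k (λ a desc′ → g≈0 (k ∷ a) (≤-pred k<1+m , desc′) (k≢x₀ ∘ ∷-injectiveˡ)))
      (lin-0# (decSum-isLinear r k))))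
    (decSum-delta r x₀ (λ a → g (x₀ ∷ a)) x desc
      (λ a desc′ a≢x → g≈0 (x₀ ∷ a) (x₀≤m , desc′) (a≢x ∘ ∷-injectiveʳ))))

  boxSum-∷ʳ : ∀ r D (g : Vec ℕ (suc r) → Carrier) → boxSum (suc r) D g ≈ boxSum r D (λ v → sumBelow D (λ b → g (v ∷ʳ b)))
  boxSum-∷ʳ zero D g = refl
  boxSum-∷ʳ (suc r) D g = sumBelow-cong< D (λ b _ → boxSum-∷ʳ r D (λ v → g (b ∷ v)))

  boxSum-reverse : ∀ r D (g : Vec ℕ r → Carrier) → boxSum r D g ≈ boxSum r D (λ v → g (reverse v))
  boxSum-reverse zero D g = refl
  boxSum-reverse (suc r) D g = begin
    boxSum (suc r) D g                                         ≈⟨ boxSum-∷ʳ r D g ⟩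
    boxSum r D (λ v → sumBelow D (λ b → g (v ∷ʳ b)))            ≈⟨ lin-boxSum (sumBelow-isLinear D) r D (λ v b → g (v ∷ʳ b)) ⟨
    sumBelow D (λ b → boxSum r D (λ v → g (v ∷ʳ b)))            ≈⟨ sumBelow-cong< D (λ b _ → boxSum-reverse r D (λ v → g (v ∷ʳ b))) ⟩
    sumBelow D (λ b → boxSum r D (λ v → g (reverse v ∷ʳ b)))    ≈⟨ sumBelow-cong< D (λ b _ → lin-cong (boxSum-isLinear r D)
                                                                     (λ v → reflexive (cong g (≡.sym (reverse-∷ b v))))) ⟩
    boxSum (suc r) D (λ v → g (reverse v))                      ∎

  listSum-cong∈ : ∀ {X : Set} (xs : List X) {g h : X → Carrier} →
                  (∀ x → x ∈ xs → g x ≈ h x) → listSum (List.map g xs) ≈ listSum (List.map h xs)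
  listSum-cong∈ [] g≈h = refl
  listSum-cong∈ (x ∷ xs) g≈h = +-cong (g≈h x (here ≡.refl)) (listSum-cong∈ xs (λ y y∈ → g≈h y (there y∈)))

  listSum-↭ : ∀ {xs ys} → xs ↭ ys → listSum xs ≈ listSum ys
  listSum-↭ p = SetoidPerm.foldr-commMonoid +-isCommutativeMonoid (↭⇒↭ₛ′ isEquivalence p)

  vecSum : ∀ {n} → Vec Carrier n → Carrier
  vecSum = Vec.foldr _ _+_ 0#

  vecSum≡listSum : ∀ {n} (v : Vec Carrier n) → vecSum v ≡ listSum (toList v)
  vecSum≡listSum [] = ≡.refl
  vecSum≡listSum (x ∷ v) = cong (x +_) (vecSum≡listSum v)

  vecSum-map-↭ : ∀ {A : Set} {n} (g : A → Carrier) (a b : Vec A n) → toList a ↭ toList b →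
                 vecSum (Vec.map g a) ≈ vecSum (Vec.map g b)
  vecSum-map-↭ g a b p = begin
    vecSum (Vec.map g a)               ≡⟨ ≡.trans (vecSum≡listSum (Vec.map g a)) (cong listSum (toList-map g a)) ⟩
    listSum (List.map g (toList a))    ≈⟨ listSum-↭ (map⁺ g p) ⟩
    listSum (List.map g (toList b))    ≡⟨ ≡.trans (vecSum≡listSum (Vec.map g b)) (cong listSum (toList-map g b)) ⟨
    vecSum (Vec.map g b)               ∎

module Multinomial {c ℓ} (R : CommutativeRing c ℓ) where
  open CommutativeRing R
  open Ops R
  open Powers R
  open Sums R
  open import Algebra.Properties.Semiring.Sum semiring using (sum; sum-init-last; sum-cong-≋)
  open import Algebra.Properties.CommutativeSemiring.Binomial commutativeSemiring using (theorem; binomialTerm)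
  open import Algebra.Properties.Semiring.Mult semiring using () renaming (_×_ to _·_)
  open import Algebra.Properties.Semiring.Exp semiring using (_^_)
  open import Relation.Binary.Reasoning.Setoid setoid

  sumBelow≈sum : ∀ n (f : ℕ → Carrier) → sumBelow n f ≈ sum (λ (i : Fin n) → f (toℕ i))
  sumBelow≈sum zero f = refl
  sumBelow≈sum (suc n) f = begin
    sumBelow n f + f n
      ≈⟨ +-cong (sumBelow≈sum n f) (reflexive (cong f (≡.sym (toℕ-fromℕ n)))) ⟩
    sum {n} (λ i → f (toℕ i)) + f (toℕ (Fin.fromℕ n))
      ≈⟨ +-congʳ (sum-cong-≋ {n} (λ i → reflexive (cong f (≡.sym (toℕ-inject₁ i))))) ⟩
    sum {n} (λ i → f (toℕ (Fin.inject₁ i))) + f (toℕ (Fin.fromℕ n))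
      ≈⟨ sum-init-last {n} (λ i → f (toℕ i)) ⟨
    sum {suc n} (λ i → f (toℕ i))
      ∎

  binomial : ∀ n x y → sumTo n (λ k → fromℕ (n C k) * (pow x k * pow y (n ∸ k))) ≈ pow (x + y) n
  binomial n x y = begin
    sumTo n (λ k → fromℕ (n C k) * (pow x k * pow y (n ∸ k)))
      ≈⟨ sumTo≈sumBelow n _ ⟩
    sumBelow (suc n) (λ k → fromℕ (n C k) * (pow x k * pow y (n ∸ k)))
      ≈⟨ sumBelow≈sum (suc n) _ ⟩
    sum {suc n} (λ i → fromℕ (n C toℕ i) * (pow x (toℕ i) * pow y (n ∸ toℕ i)))
      ≈⟨ sum-cong-≋ {suc n} (λ i → trans (fromℕ-*≈· (n C toℕ i) _)
           (reflexive (cong₂ (λ u v → (n C toℕ i) · (u * v)) (pow≡^ x (toℕ i)) (pow≡^ y (n ∸ toℕ i))))) ⟩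
    sum (binomialTerm x y n)
      ≈⟨ theorem n x y ⟨
    (x + y) ^ n
      ≡⟨ pow≡^ (x + y) n ⟨
    pow (x + y) n
      ∎

  multinomial : ∀ r n y (v : Vec ℕ r) → multiSum r n (λ q → pow y (dot v q)) ≈ pow (1# + vecSum (Vec.map (pow y) v)) n
  multinomial zero n y [] = sym (trans (pow-cong n (+-identityʳ 1#)) (pow-1# n))
  multinomial (suc r) n y (v₀ ∷ v) = begin
    sumTo n (λ q → fromℕ (n C q) * multiSum r (n ∸ q) (λ w → pow y (v₀ ℕ.* q ℕ.+ dot v w)))
      ≈⟨ lin-cong (sumTo-isLinear n) (λ q → *-congˡ (tail q)) ⟩
    sumTo n (λ q → fromℕ (n C q) * (pow (pow y v₀) q * pow (1# + s) (n ∸ q)))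
      ≈⟨ binomial n (pow y v₀) (1# + s) ⟩
    pow (pow y v₀ + (1# + s)) n
      ≈⟨ pow-cong n (+-leftComm (pow y v₀) 1# s) ⟩
    pow (1# + (pow y v₀ + s)) n
      ∎
    where
    s = vecSum (Vec.map (pow y) v)
    tail : ∀ q → multiSum r (n ∸ q) (λ w → pow y (v₀ ℕ.* q ℕ.+ dot v w)) ≈ pow (pow y v₀) q * pow (1# + s) (n ∸ q)
    tail q = begin
      multiSum r (n ∸ q) (λ w → pow y (v₀ ℕ.* q ℕ.+ dot v w))
        ≈⟨ lin-cong (multiSum-isLinear r (n ∸ q)) (λ w → trans (pow-+ y (v₀ ℕ.* q) (dot v w)) (*-congʳ (pow-* y v₀ q))) ⟩
      multiSum r (n ∸ q) (λ w → pow (pow y v₀) q * pow y (dot v w))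
        ≈⟨ lin-*ˡ (multiSum-isLinear r (n ∸ q)) _ _ ⟩
      pow (pow y v₀) q * multiSum r (n ∸ q) (λ w → pow y (dot v w))
        ≈⟨ *-congˡ (multinomial r (n ∸ q) y v) ⟩
      pow (pow y v₀) q * pow (1# + s) (n ∸ q)
        ∎

module RootsOfUnity {c ℓ} (R : CommutativeRing c ℓ) where
  open CommutativeRing R
  open Ops R
  open Powers R
  open Sums R
  open import Algebra.Properties.Ring ring using (-‿distribʳ-*)
  open import Algebra.Properties.Group +-group using (∙-cancelʳ; x∙y⁻¹≈ε⇒x≈y; x≈y⇒x∙y⁻¹≈ε)
  open import Relation.Binary.Reasoning.Setoid setoid

  geometric : ∀ w n → sumBelow n (pow w) * w + 1# ≈ sumBelow n (pow w) + pow w n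
  geometric w zero = +-congʳ (zeroˡ w)
  geometric w (suc n) = begin
    (S + pow w n) * w + 1#       ≈⟨ +-congʳ (distribʳ w S (pow w n)) ⟩
    (S * w + pow w n * w) + 1#   ≈⟨ +-assoc _ _ _ ⟩
    S * w + (pow w n * w + 1#)   ≈⟨ +-congˡ (+-comm _ _) ⟩
    S * w + (1# + pow w n * w)   ≈⟨ +-assoc _ _ _ ⟨
    (S * w + 1#) + pow w n * w   ≈⟨ +-cong (geometric w n) (*-comm _ _) ⟩
    (S + pow w n) + w * pow w n  ∎
    where S = sumBelow n (pow w)

  geometric-vanishes : (∀ x y → x * y ≈ 0# → x ≈ 0# ⊎ y ≈ 0#) →
                       ∀ D w → pow w D ≈ 1# → ¬ w ≈ 1# → sumBelow D (pow w) ≈ 0#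
  geometric-vanishes noZeroDivisors D w w^D≈1 w≉1 =
    [ (λ S≈0 → S≈0) , (λ w-1≈0 → ⊥-elim (w≉1 (x∙y⁻¹≈ε⇒x≈y w 1# w-1≈0))) ]′
      (noZeroDivisors S (w - 1#) S*[w-1]≈0)
    where
    S = sumBelow D (pow w)
    S*w≈S : S * w ≈ S
    S*w≈S = ∙-cancelʳ 1# _ _ (trans (geometric w D) (+-congˡ w^D≈1))
    S*[w-1]≈0 : S * (w - 1#) ≈ 0#
    S*[w-1]≈0 = begin
      S * (w - 1#)        ≈⟨ distribˡ S w (- 1#) ⟩
      S * w + S * - 1#    ≈⟨ +-congˡ (-‿distribʳ-* S 1#) ⟨
      S * w + - (S * 1#)  ≈⟨ +-congˡ (-‿cong (*-identityʳ S)) ⟩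
      S * w - S           ≈⟨ x≈y⇒x∙y⁻¹≈ε S*w≈S ⟩
      0#                  ∎

  module _ (D : ℕ) where

    pow-root : ∀ {x} → pow x D ≈ 1# → ∀ b → pow (pow x b) D ≈ 1#
    pow-root {x} x^D≈1 b = begin
      pow (pow x b) D  ≈⟨ pow-* x b D ⟨
      pow x (b ℕ.* D)  ≡⟨ cong (pow x) (ℕ.*-comm b D) ⟩
      pow x (D ℕ.* b)  ≈⟨ pow-* x D b ⟩
      pow (pow x D) b  ≈⟨ pow-cong b x^D≈1 ⟩
      pow 1# b         ≈⟨ pow-1# b ⟩
      1#               ∎

    pow-root-mod : ∀ {x} .{{_ : NonZero D}} → pow x D ≈ 1# → ∀ q → pow x q ≈ pow x (q % D)
    pow-root-mod {x} x^D≈1 q = begin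
      pow x q                                ≡⟨ cong (pow x) (m≡m%n+[m/n]*n q D) ⟩
      pow x (q % D ℕ.+ q / D ℕ.* D)          ≈⟨ pow-+ x (q % D) _ ⟩
      pow x (q % D) * pow x (q / D ℕ.* D)    ≡⟨ cong (λ e → pow x (q % D) * pow x e) (ℕ.*-comm (q / D) D) ⟩
      pow x (q % D) * pow x (D ℕ.* (q / D))  ≈⟨ *-congˡ (trans (pow-* x D (q / D)) (trans (pow-cong (q / D) x^D≈1) (pow-1# (q / D)))) ⟩
      pow x (q % D) * 1#                     ≈⟨ *-identityʳ _ ⟩
      pow x (q % D)                          ∎

  module Primitive (noZeroDivisors : ∀ x y → x * y ≈ 0# → x ≈ 0# ⊎ y ≈ 0#)
                   (D : ℕ) .{{_ : NonZero D}} (ζ ζinv : Carrier) (ζζinv≈1 : ζ * ζinv ≈ 1#) (ζ^D≈1 : pow ζ D ≈ 1#)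
                   (ζ-primitive : ∀ k → 1 ≤ k → k < D → ¬ pow ζ k ≈ 1#) where

    pow-inverse : ∀ n → pow ζ n * pow ζinv n ≈ 1#
    pow-inverse n = trans (sym (pow-distrib-* ζ ζinv n)) (trans (pow-cong n ζζinv≈1) (pow-1# n))

    ζinv^D≈1 : pow ζinv D ≈ 1#
    ζinv^D≈1 = trans (sym (*-identityˡ _)) (trans (*-congʳ (sym ζ^D≈1)) (pow-inverse D))

    pow-cancelˡ : ∀ b {x y} → pow ζ b * x ≈ pow ζ b * y → x ≈ y
    pow-cancelˡ b {x} {y} e = begin
      x                             ≈⟨ *-identityˡ x ⟨
      1# * x                        ≈⟨ *-congʳ (trans (*-comm _ _) (pow-inverse b)) ⟨
      (pow ζinv b * pow ζ b) * x    ≈⟨ *-assoc _ _ _ ⟩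
      pow ζinv b * (pow ζ b * x)    ≈⟨ *-congˡ e ⟩
      pow ζinv b * (pow ζ b * y)    ≈⟨ *-assoc _ _ _ ⟨
      (pow ζinv b * pow ζ b) * y    ≈⟨ *-congʳ (trans (*-comm _ _) (pow-inverse b)) ⟩
      1# * y                        ≈⟨ *-identityˡ y ⟩
      y                             ∎

    pow-injective-≤ : ∀ {b t} → b ≤ t → t < D → pow ζ b ≈ pow ζ t → b ≡ t
    pow-injective-≤ {b} {t} b≤t t<D ζ^b≈ζ^t with m≤n⇒m<n∨m≡n b≤t
    ... | inj₂ b≡t = b≡t
    ... | inj₁ b<t = ⊥-elim (ζ-primitive (t ∸ b) (m<n⇒0<n∸m b<t) (≤-<-trans (m∸n≤m t b) t<D) (pow-cancelˡ b (begin
      pow ζ b * pow ζ (t ∸ b)  ≈⟨ pow-+ ζ b (t ∸ b) ⟨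
      pow ζ (b ℕ.+ (t ∸ b))    ≡⟨ cong (pow ζ) (m+[n∸m]≡n b≤t) ⟩
      pow ζ t                  ≈⟨ ζ^b≈ζ^t ⟨
      pow ζ b                  ≈⟨ *-identityʳ _ ⟨
      pow ζ b * 1#             ∎)))

    pow-injective : ∀ {b t} → b < D → t < D → pow ζ b ≈ pow ζ t → b ≡ t
    pow-injective {b} {t} b<D t<D ζ^b≈ζ^t with ℕ.≤-total b t
    ... | inj₁ b≤t = pow-injective-≤ b≤t t<D ζ^b≈ζ^t
    ... | inj₂ t≤b = ≡.sym (pow-injective-≤ t≤b b<D (sym ζ^b≈ζ^t))

    character : ℕ → ℕ → Carrier
    character b q = sumBelow D (λ k → pow ζ (k ℕ.* b) * pow ζinv (k ℕ.* q))

    character-geometric : ∀ b q → character b q ≈ sumBelow D (pow (pow ζ b * pow ζinv q))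
    character-geometric b q = sumBelow-cong< D (λ k _ → begin
      pow ζ (k ℕ.* b) * pow ζinv (k ℕ.* q)  ≡⟨ cong₂ (λ e f → pow ζ e * pow ζinv f) (ℕ.*-comm k b) (ℕ.*-comm k q) ⟩
      pow ζ (b ℕ.* k) * pow ζinv (q ℕ.* k)  ≈⟨ *-cong (pow-* ζ b k) (pow-* ζinv q k) ⟩
      pow (pow ζ b) k * pow (pow ζinv q) k  ≈⟨ pow-distrib-* _ _ k ⟨
      pow (pow ζ b * pow ζinv q) k          ∎)

    character-diagonal : ∀ q → character (q % D) q ≈ fromℕ D
    character-diagonal q = begin
      character (q % D) q                              ≈⟨ character-geometric (q % D) q ⟩
      sumBelow D (pow (pow ζ (q % D) * pow ζinv q))     ≈⟨ sumBelow-cong< D (λ k _ → trans (pow-cong k w≈1) (pow-1# k)) ⟩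
      sumBelow D (λ _ → 1#)                            ≈⟨ sumBelow-1# D ⟩
      fromℕ D                                          ∎
      where
      w≈1 : pow ζ (q % D) * pow ζinv q ≈ 1#
      w≈1 = trans (*-congˡ (pow-root-mod D ζinv^D≈1 q)) (pow-inverse (q % D))

    character-offDiagonal : ∀ b q → b < D → b ≢ q % D → character b q ≈ 0#
    character-offDiagonal b q b<D b≢t = trans (character-geometric b q) (geometric-vanishes noZeroDivisors D w w^D≈1 w≉1)
      where
      t = q % D
      w = pow ζ b * pow ζinv q
      w^D≈1 : pow w D ≈ 1#
      w^D≈1 = trans (pow-distrib-* _ _ D) (trans (*-cong (pow-root D ζ^D≈1 b) (pow-root D ζinv^D≈1 q)) (*-identityˡ 1#))
      w≉1 : ¬ w ≈ 1#
      w≉1 w≈1 = b≢t (pow-injective b<D (m%n<n q D) (begin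
        pow ζ b                               ≈⟨ *-identityʳ _ ⟨
        pow ζ b * 1#                          ≈⟨ *-congˡ (trans (*-comm _ _) (pow-inverse t)) ⟨
        pow ζ b * (pow ζinv t * pow ζ t)      ≈⟨ *-assoc _ _ _ ⟨
        (pow ζ b * pow ζinv t) * pow ζ t      ≈⟨ *-congʳ (*-congˡ (pow-root-mod D ζinv^D≈1 q)) ⟨
        w * pow ζ t                           ≈⟨ *-congʳ w≈1 ⟩
        1# * pow ζ t                          ≈⟨ *-identityˡ _ ⟩
        pow ζ t                               ∎))

    characterProduct : ∀ {r} → Vec ℕ r → Vec ℕ r → Carrier
    characterProduct [] [] = 1#
    characterProduct (b ∷ bs) (q ∷ qs) = character b q * characterProduct bs qs

    boxSum-character : ∀ r (b q : Vec ℕ r) →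
                       boxSum r D (λ a → pow ζ (dot a b) * pow ζinv (dot a q)) ≈ characterProduct b q
    boxSum-character zero [] [] = *-identityˡ 1#
    boxSum-character (suc r) (b₀ ∷ b) (q₀ ∷ q) = begin
      sumBelow D (λ a₀ → boxSum r D (λ a → pow ζ (a₀ ℕ.* b₀ ℕ.+ dot a b) * pow ζinv (a₀ ℕ.* q₀ ℕ.+ dot a q)))
        ≈⟨ sumBelow-cong< D (λ a₀ _ → trans (lin-cong box (λ a → split a₀ a)) (lin-*ˡ box _ _)) ⟩
      sumBelow D (λ a₀ → (pow ζ (a₀ ℕ.* b₀) * pow ζinv (a₀ ℕ.* q₀)) * boxSum r D (λ a → pow ζ (dot a b) * pow ζinv (dot a q)))
        ≈⟨ sumBelow-cong< D (λ a₀ _ → *-congˡ (boxSum-character r b q)) ⟩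
      sumBelow D (λ a₀ → (pow ζ (a₀ ℕ.* b₀) * pow ζinv (a₀ ℕ.* q₀)) * characterProduct b q)
        ≈⟨ lin-*ʳ (sumBelow-isLinear D) _ _ ⟩
      character b₀ q₀ * characterProduct b q
        ∎
      where
      split : ∀ a₀ a → pow ζ (a₀ ℕ.* b₀ ℕ.+ dot a b) * pow ζinv (a₀ ℕ.* q₀ ℕ.+ dot a q) ≈
                       (pow ζ (a₀ ℕ.* b₀) * pow ζinv (a₀ ℕ.* q₀)) * (pow ζ (dot a b) * pow ζinv (dot a q))
      split a₀ a = trans (*-cong (pow-+ ζ (a₀ ℕ.* b₀) (dot a b)) (pow-+ ζinv (a₀ ℕ.* q₀) (dot a q))) (*-interchange _ _ _ _)
      box = boxSum-isLinear r D

    characterProduct-orthogonality : ∀ r (g : Vec ℕ r → Carrier) (q : Vec ℕ r) →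
      boxSum r D (λ b → g b * characterProduct b q) ≈ pow (fromℕ D) r * g (Vec.map (_% D) q)
    characterProduct-orthogonality zero g [] = trans (*-identityʳ _) (sym (*-identityˡ _))
    characterProduct-orthogonality (suc r) g (q₀ ∷ q) = begin
      sumBelow D (λ b₀ → boxSum r D (λ b → g (b₀ ∷ b) * (character b₀ q₀ * characterProduct b q)))
        ≈⟨ sumBelow-cong< D (λ b₀ _ → trans (lin-cong (boxSum-isLinear r D) (λ b → *-leftComm _ _ _))
                                             (lin-*ˡ (boxSum-isLinear r D) _ _)) ⟩
      sumBelow D (λ b₀ → character b₀ q₀ * boxSum r D (λ b → g (b₀ ∷ b) * characterProduct b q))
        ≈⟨ sumBelow-cong< D (λ b₀ _ → *-congˡ (characterProduct-orthogonality r (λ b → g (b₀ ∷ b)) q)) ⟩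
      sumBelow D (λ b₀ → character b₀ q₀ * (pow (fromℕ D) r * g (b₀ ∷ q%D)))
        ≈⟨ sumBelow-delta D _ (q₀ % D) (m%n<n q₀ D)
             (λ b₀ b₀<D b₀≢ → trans (*-congʳ (character-offDiagonal b₀ q₀ b₀<D b₀≢)) (zeroˡ _)) ⟩
      character (q₀ % D) q₀ * (pow (fromℕ D) r * g (q₀ % D ∷ q%D))
        ≈⟨ trans (*-congʳ (character-diagonal q₀)) (sym (*-assoc _ _ _)) ⟩
      pow (fromℕ D) (suc r) * g (q₀ % D ∷ q%D)
        ∎
      where q%D = Vec.map (_% D) q

    fourier-inversion : ∀ r (g : Vec ℕ r → Carrier) (q : Vec ℕ r) →
      boxSum r D (λ a → boxSum r D (λ b → g b * pow ζ (dot a b)) * pow ζinv (dot a q)) ≈ pow (fromℕ D) r * g (Vec.map (_% D) q)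
    fourier-inversion r g q = begin
      boxSum r D (λ a → boxSum r D (λ b → g b * pow ζ (dot a b)) * pow ζinv (dot a q))
        ≈⟨ lin-cong box (λ a → trans (sym (lin-*ʳ box _ _)) (lin-cong box (λ b → *-assoc _ _ _))) ⟩
      boxSum r D (λ a → boxSum r D (λ b → g b * (pow ζ (dot a b) * pow ζinv (dot a q))))
        ≈⟨ lin-boxSum box r D (λ b a → g b * (pow ζ (dot a b) * pow ζinv (dot a q))) ⟩
      boxSum r D (λ b → boxSum r D (λ a → g b * (pow ζ (dot a b) * pow ζinv (dot a q))))
        ≈⟨ lin-cong box (λ b → trans (lin-*ˡ box _ _) (*-congˡ (boxSum-character r b q))) ⟩
      boxSum r D (λ b → g b * characterProduct b q)
        ≈⟨ characterProduct-orthogonality r g q ⟩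
      pow (fromℕ D) r * g (Vec.map (_% D) q)
        ∎
      where box = boxSum-isLinear r D

module Regrouping {c ℓ} (R : CommutativeRing c ℓ) {r : ℕ} where
  open CommutativeRing R
  open Ops R
  open Sums R
  open import Relation.Binary.Reasoning.Setoid setoid

  _≟v_ : DecidableEquality (Vec ℕ r)
  _≟v_ = ≡-dec ℕ._≟_

  open import Data.List.Membership.DecPropositional _≟v_ using (_∈?_)

  indicator : ∀ {P : Set} → Dec P → Carrier → Carrier
  indicator P? y = if does P? then y else 0#

  indicator-yes : ∀ {P : Set} (P? : Dec P) y → P → indicator P? y ≈ y
  indicator-yes (yes _) y _ = refl
  indicator-yes (no ¬p) y p = ⊥-elim (¬p p)

  indicator-no : ∀ {P : Set} (P? : Dec P) y → ¬ P → indicator P? y ≈ 0#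
  indicator-no (yes p) y ¬p = ⊥-elim (¬p p)
  indicator-no (no _) y _ = refl

  indicator-⊎ : ∀ {P Q : Set} (P? : Dec P) (Q? : Dec Q) → (P → ¬ Q) → ∀ y →
                indicator (P? ⊎-dec Q?) y ≈ indicator P? y + indicator Q? y
  indicator-⊎ (yes p) (yes q) disjoint y = ⊥-elim (disjoint p q)
  indicator-⊎ (yes _) (no _) _ y = sym (+-identityʳ y)
  indicator-⊎ (no _) Q? _ y = sym (+-identityˡ _)

  listSum-as-boxSum : ∀ D (xs : List (Vec ℕ r)) (H : Vec ℕ r → Carrier) → Unique xs → All (InBox D) xs →
                      listSum (List.map H xs) ≈ boxSum r D (λ a → indicator (a ∈? xs) (H a))
  listSum-as-boxSum D [] H _ _ = sym (lin-0# (boxSum-isLinear r D))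
  listSum-as-boxSum D (x ∷ xs) H (x∉xs ∷ unique) (x∈Box ∷ xs∈Box) = begin
    H x + listSum (List.map H xs)
      ≈⟨ +-cong (sym atX) (listSum-as-boxSum D xs H unique xs∈Box) ⟩
    boxSum r D (λ a → indicator (a ≟v x) (H a)) + boxSum r D (λ a → indicator (a ∈? xs) (H a))
      ≈⟨ lin-+ (boxSum-isLinear r D) _ _ ⟨
    boxSum r D (λ a → indicator (a ≟v x) (H a) + indicator (a ∈? xs) (H a))
      ≈⟨ lin-cong (boxSum-isLinear r D)
           -- a ∈? (x ∷ xs) computes to (a ≟v x) ⊎-dec (a ∈? xs) up to the proof component, which indicator ignores.
           (λ a → sym (indicator-⊎ (a ≟v x) (a ∈? xs) (λ { ≡.refl x∈xs → All.lookup x∉xs x∈xs ≡.refl }) (H a))) ⟩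
    boxSum r D (λ a → indicator (a ∈? (x ∷ xs)) (H a))
      ∎
    where
    atX : boxSum r D (λ a → indicator (a ≟v x) (H a)) ≈ H x
    atX = trans (boxSum-delta r D _ x x∈Box (λ a _ a≢x → indicator-no (a ≟v x) (H a) a≢x))
                (indicator-yes (x ≟v x) (H x) ≡.refl)

  module _ (Sym : Vec ℕ r → List (Vec ℕ r)) (Sym-unique : ∀ j → Unique (Sym j))
           (Sym-↭ : ∀ j j′ → (j′ ∈ Sym j) ⇔ (toList j′ ↭ toList j)) where

    Sym-inBox : ∀ m j → Descending m j → All (InBox (suc m)) (Sym j)
    Sym-inBox m j desc =
      All.tabulate (λ {a} a∈ → All-resp-↭ (↭-sym (Equivalence.to (Sym-↭ j a) a∈)) (descending-inBox m j desc))

    Sym-sortDesc : ∀ a → a ∈ Sym (sortDesc a)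
    Sym-sortDesc a = Equivalence.from (Sym-↭ (sortDesc a) a) (↭-sym (sortDesc-↭ a))

    Sym-descending-unique : ∀ m a j → InBox (suc m) a → Descending m j → a ∈ Sym j → j ≡ sortDesc a
    Sym-descending-unique m a j a∈Box desc a∈ = descending-↭-unique j (sortDesc a) desc (sortDesc-descending m a a∈Box)
      (↭-trans (↭-sym (Equivalence.to (Sym-↭ j a) a∈)) (↭-sym (sortDesc-↭ a)))

    decSum-Sym≈boxSum : ∀ m (H : Vec ℕ r → Carrier) → decSum r m (λ j → listSum (List.map H (Sym j))) ≈ boxSum r (suc m) H
    decSum-Sym≈boxSum m H = begin
      decSum r m (λ j → listSum (List.map H (Sym j)))
        ≈⟨ decSum-cong r m (λ j desc → listSum-as-boxSum (suc m) (Sym j) H (Sym-unique j) (Sym-inBox m j desc)) ⟩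
      decSum r m (λ j → boxSum r (suc m) (λ a → indicator (a ∈? Sym j) (H a)))
        ≈⟨ lin-boxSum (decSum-isLinear r m) r (suc m) (λ a j → indicator (a ∈? Sym j) (H a)) ⟩
      boxSum r (suc m) (λ a → decSum r m (λ j → indicator (a ∈? Sym j) (H a)))
        ≈⟨ boxSum-cong r (suc m) (λ a a∈Box → trans
             (decSum-delta r m _ (sortDesc a) (sortDesc-descending m a a∈Box)
               (λ j desc j≢ → indicator-no (a ∈? Sym j) (H a) (j≢ ∘ Sym-descending-unique m a j a∈Box desc)))
             (indicator-yes (a ∈? Sym (sortDesc a)) (H a) (Sym-sortDesc a))) ⟩
      boxSum r (suc m) H
        ∎

module Expansion {c ℓ} (R : CommutativeRing c ℓ) where
  open CommutativeRing R
  open Ops R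
  open Powers R
  open Sums R
  open Multinomial R
  open RootsOfUnity R
  open Regrouping R
  open import Relation.Binary.Reasoning.Setoid setoid

  module Setting
    (noZeroDivisors : ∀ x y → x * y ≈ 0# → x ≈ 0# ⊎ y ≈ 0#)
    {r D′ : ℕ} (F : Vec ℤ r → ℤ) (F-periodic : Periodic (suc D′) F)
    (ξ ξinv ζ ζinv : Carrier) (ζζinv≈1 : ζ * ζinv ≈ 1#) (ζ^D≈1 : pow ζ (suc D′) ≈ 1#)
    (ζ-primitive : ∀ k → 1 ≤ k → k < suc D′ → ¬ pow ζ k ≈ 1#)
    (δ : Carrier) (δD≈1 : δ * fromℕ (suc D′) ≈ 1#)
    (Sym : Vec ℕ r → List (Vec ℕ r)) (Sym-unique : ∀ j → Unique (Sym j))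
    (Sym-↭ : ∀ j j′ → (j′ ∈ Sym j) ⇔ (toList j′ ↭ toList j)) where

    open Primitive noZeroDivisors (suc D′) ζ ζinv ζζinv≈1 ζ^D≈1 ζ-primitive
    open Setup (suc D′) F ξ ξinv ζ ζinv δ Sym

    D : ℕ
    D = suc D′

    f : Vec ℕ r → Carrier
    f q = zpow ξ ξinv (F (Vec.map ℤ.+_ q))

    fourierCoefficient : Vec ℕ r → Carrier
    fourierCoefficient a = pow δ r * boxSum r D (λ b → f b * pow ζ (revDot a b))

    f-reverse-mod : ∀ q → f (reverse (Vec.map (_% D) (reverse q))) ≡ f q
    f-reverse-mod q = ≡.trans (cong (f ∘ reverse) (map-reverse (_% D) q))
                              (≡.trans (cong f (reverse-involutive (Vec.map (_% D) q)))
                                       (cong (zpow ξ ξinv) (periodic-mod F-periodic q)))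

    fourier-expansion : ∀ q → f q ≈ boxSum r D (λ a → fourierCoefficient a * pow ζinv (revDot a q))
    fourier-expansion q = sym (begin
      boxSum r D (λ a → fourierCoefficient a * pow ζinv (revDot a q))
        ≈⟨ trans (lin-cong box (λ a → *-assoc _ _ _)) (lin-*ˡ box _ _) ⟩
      pow δ r * boxSum r D (λ a → boxSum r D (λ b → f b * pow ζ (revDot a b)) * pow ζinv (dot a (reverse q)))
        ≈⟨ *-congˡ (lin-cong box (λ a → *-congʳ (boxSum-reverse r D _))) ⟩
      pow δ r * boxSum r D (λ a → boxSum r D (λ b → f (reverse b) * pow ζ (dot a (reverse (reverse b)))) * pow ζinv (dot a (reverse q)))
        ≈⟨ *-congˡ (lin-cong box (λ a → *-congʳ (lin-cong box (λ b →
             reflexive (cong (λ v → f (reverse b) * pow ζ (dot a v)) (reverse-involutive b)))))) ⟩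
      pow δ r * boxSum r D (λ a → boxSum r D (λ b → f (reverse b) * pow ζ (dot a b)) * pow ζinv (dot a (reverse q)))
        ≈⟨ *-congˡ (fourier-inversion r (f ∘ reverse) (reverse q)) ⟩
      pow δ r * (pow (fromℕ D) r * f (reverse (Vec.map (_% D) (reverse q))))
        ≈⟨ *-assoc _ _ _ ⟨
      (pow δ r * pow (fromℕ D) r) * f (reverse (Vec.map (_% D) (reverse q)))
        ≈⟨ *-cong δ^r*D^r≈1 (reflexive (f-reverse-mod q)) ⟩
      1# * f q
        ≈⟨ *-identityˡ _ ⟩
      f q
        ∎)
      where
      box = boxSum-isLinear r D
      δ^r*D^r≈1 : pow δ r * pow (fromℕ D) r ≈ 1#
      δ^r*D^r≈1 = trans (sym (pow-distrib-* δ _ r)) (trans (pow-cong r δD≈1) (pow-1# r))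

    base-↭ : ∀ a b → toList a ↭ toList b → base a ≈ base b
    base-↭ a b p = +-congˡ (vecSum-map-↭ (pow ζinv) a b p)

    character-multiSum : ∀ n a → multiSum r n (λ q → pow ζinv (revDot a q)) ≈ pow (base a) n
    character-multiSum n a = begin
      multiSum r n (λ q → pow ζinv (revDot a q))
        ≈⟨ lin-cong (multiSum-isLinear r n) (λ q → reflexive (cong (pow ζinv) (revDot≡dot-reverse a q))) ⟩
      multiSum r n (λ q → pow ζinv (dot (reverse a) q))
        ≈⟨ multinomial r n ζinv (reverse a) ⟩
      pow (base (reverse a)) n
        ≈⟨ pow-cong n (base-↭ (reverse a) a reverse-↭) ⟩
      pow (base a) n
        ∎
      where
      reverse-↭ : toList (reverse a) ↭ toList a
      reverse-↭ = ≡.subst (_↭ toList a) (≡.sym (toList-reverse a)) (↭-reverse (toList a))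

    S≈boxSum : ∀ n → S n ≈ boxSum r D (λ a → fourierCoefficient a * pow (base a) n)
    S≈boxSum n = begin
      multiSum r n f
        ≈⟨ lin-cong (multiSum-isLinear r n) fourier-expansion ⟩
      multiSum r n (λ q → boxSum r D (λ a → fourierCoefficient a * pow ζinv (revDot a q)))
        ≈⟨ lin-boxSum (multiSum-isLinear r n) r D (λ a q → fourierCoefficient a * pow ζinv (revDot a q)) ⟩
      boxSum r D (λ a → multiSum r n (λ q → fourierCoefficient a * pow ζinv (revDot a q)))
        ≈⟨ lin-cong (boxSum-isLinear r D) (λ a → trans (lin-*ˡ (multiSum-isLinear r n) _ _) (*-congˡ (character-multiSum n a))) ⟩
      boxSum r D (λ a → fourierCoefficient a * pow (base a) n)
        ∎

    coeff-term : ∀ n j → coeff j * pow (base j) n ≈ listSum (List.map (λ a → fourierCoefficient a * pow (base a) n) (Sym j))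
    coeff-term n j = begin
      (pow δ r * boxSum r D (λ b → f b * listSum (List.map (λ j′ → pow ζ (revDot j′ b)) (Sym j)))) * pow (base j) n
        ≈⟨ *-congʳ (*-congˡ (trans (lin-cong (boxSum-isLinear r D) (λ b → sym (lin-*ˡ sym-sum _ _)))
                                     (lin-listSum (boxSum-isLinear r D) (Sym j) (λ j′ b → f b * pow ζ (revDot j′ b))))) ⟩
      (pow δ r * listSum (List.map (λ j′ → boxSum r D (λ b → f b * pow ζ (revDot j′ b))) (Sym j))) * pow (base j) n
        ≈⟨ trans (*-congʳ (sym (lin-*ˡ sym-sum _ _))) (sym (lin-*ʳ sym-sum _ _)) ⟩
      listSum (List.map (λ j′ → fourierCoefficient j′ * pow (base j) n) (Sym j))
        ≈⟨ listSum-cong∈ (Sym j) (λ j′ j′∈ →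
             *-congˡ (pow-cong n (sym (base-↭ j′ j (Equivalence.to (Sym-↭ j j′) j′∈))))) ⟩
      listSum (List.map (λ a → fourierCoefficient a * pow (base a) n) (Sym j))
        ∎
      where sym-sum = listSum-isLinear (Sym j)

    S≈RHS : ∀ n → S n ≈ RHS n
    S≈RHS n = begin
      S n
        ≈⟨ S≈boxSum n ⟩
      boxSum r D (λ a → fourierCoefficient a * pow (base a) n)
        ≈⟨ decSum-Sym≈boxSum Sym Sym-unique Sym-↭ D′ _ ⟨
      decSum r D′ (λ j → listSum (List.map (λ a → fourierCoefficient a * pow (base a) n) (Sym j)))
        ≈⟨ lin-cong (decSum-isLinear r D′) (λ j → coeff-term n j) ⟨
      RHS n
        ∎

theorem4p5 : ∀ {c ℓ} (R : CommutativeRing c ℓ) → let open CommutativeRing R in let open Ops R in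
    (∀ x y → x * y ≈ 0# → x ≈ 0# ⊎ y ≈ 0#) →
    (∀ m → ¬ (fromℕ (suc m) ≈ 0#)) →
    (r D : ℕ) → 1 ≤ r → 1 ≤ D →
    (F : Vec ℤ r → ℤ) → Periodic D F →
    (ξ ξinv : Carrier) → ξ * ξinv ≈ 1# → pow ξ D ≈ 1# →
    (ζ ζinv : Carrier) → ζ * ζinv ≈ 1# → pow ζ D ≈ 1# →
    (∀ k → 1 ≤ k → k < D → ¬ (pow ζ k ≈ 1#)) →
    (δ : Carrier) → δ * fromℕ D ≈ 1# →
    (sym : Vec ℕ r → List (Vec ℕ r)) →
    (∀ j → Unique (sym j)) →
    (∀ j j′ → (j′ ∈ sym j) ⇔ (toList j′ ↭ toList j)) →
    (n : ℕ) → Setup.S D F ξ ξinv ζ ζinv δ sym n ≈ Setup.RHS D F ξ ξinv ζ ζinv δ sym n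
-- Unused: 1 ≤ r, the characteristic condition (δ already inverts D) and the hypotheses on ξ,
-- which enters only through zpow ξ ξinv ∘ F and so inherits its periodicity from F.
theorem4p5 _ _ _ _ zero _ ()
theorem4p5 R noZeroDivisors _ _ (suc D′) _ _ F F-periodic ξ ξinv _ _ ζ ζinv ζζinv≈1 ζ^D≈1 ζ-primitive δ δD≈1 Sym Sym-unique Sym-↭ =
  Expansion.Setting.S≈RHS R noZeroDivisors F F-periodic ξ ξinv ζ ζinv ζζinv≈1 ζ^D≈1 ζ-primitive δ δD≈1 Sym Sym-unique Sym-↭
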